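{- Let $p$ be a prime and let $r,e,d$ be integers with $r\ge2$, $\frac{p-1}{2}<e\le p-1$, $1\le d\le p$. Let $f(x)=(x-x_1)\cdots(x-x_r)\in\mathbb{F}_p[x_1,\dots,x_r][x]$. Then for all $1\le i\le r$ and $1\le j\le r$, the element $\left\{\left(\frac{d}{dx}\right)^{p-d}f(x)^e\right\}[x_i^p,x_j]$ is divisible by $\prod_{1\le\ell\le r,\ \ell\ne i}(x_i-x_\ell)^{2e-(p-1)}$ in $\mathbb{F}_p[x_1,\dots,x_r]$.
   Context: $x_1,\dots,x_r$ are independent indeterminates over $\mathbb{F}_p$. For a field $K$ of characteristic $p$ and $F(x)\in K(x)$, write uniquely $F(x)=\sum_{0\le i\le p-1}F_i(x^p)x^i$ with $F_i(x^p)\in K(x^p)$, and define $F[t,x]=\sum_{0\le i\le p-1}F_i(t)x^i$ for another variable $t$; thus $F[x_i^p,x_j]$ is obtained by substituting $t=x_i^p$ and $x=x_j$. -}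

module Defs where

-- A minimal, concrete model of multivariate polynomials with integer
-- coefficients, read modulo p (i.e. polynomials over F_p).
open import Data.Nat as ℕ using (ℕ; zero; suc; _∸_; NonZero)
open import Data.Nat.DivMod using (_/_; _%_)
open import Data.Integer as ℤ using (ℤ; +_)
open import Data.Integer.Divisibility using () renaming (_∣_ to _∣ℤ_)
open import Data.Fin using (Fin; zero; suc; _≟_)
open import Data.Vec using (Vec; []; _∷_; replicate; zipWith; updateAt; lookup)
open import Data.Vec.Properties using (≡-dec)
open import Data.List using (List; []; _∷_; _++_; map; concatMap; foldr; allFin; filter)
open import Data.Product using (_×_; _,_; Σ)
open import Relation.Nullary using (yes; no; ¬_)
open import Relation.Binary.PropositionalEquality using (_≡_)

Mono : ℕ → Set
Mono n = Vec ℕ n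

Poly : ℕ → Set
Poly n = List (ℤ × Mono n)

coeff : ∀ {n} → Poly n → Mono n → ℤ
coeff [] m = + 0
coeff ((c , v) ∷ P) m with ≡-dec ℕ._≟_ v m
... | yes _ = c ℤ.+ coeff P m
... | no _  = coeff P m

_≈[_]_ : ∀ {n} → Poly n → ℕ → Poly n → Set
P ≈[ p ] Q = ∀ m → (+ p) ∣ℤ (coeff P m ℤ.- coeff Q m)

zeroₚ : ∀ {n} → Poly n
zeroₚ = []

constₚ : ∀ {n} → ℤ → Poly n
constₚ c = (c , replicate _ 0) ∷ []

oneₚ : ∀ {n} → Poly n
oneₚ = constₚ (+ 1)

varₚ : ∀ {n} → Fin n → Poly n
varₚ i = (+ 1 , updateAt (replicate _ 0) i (λ _ → 1)) ∷ []

_+ₚ_ : ∀ {n} → Poly n → Poly n → Poly n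
P +ₚ Q = P ++ Q

negₚ : ∀ {n} → Poly n → Poly n
negₚ = map (λ { (c , v) → (ℤ.- c , v) })

_-ₚ_ : ∀ {n} → Poly n → Poly n → Poly n
P -ₚ Q = P +ₚ negₚ Q

_*ₚ_ : ∀ {n} → Poly n → Poly n → Poly n
P *ₚ Q = concatMap (λ { (c , v) → map (λ { (d , w) → (c ℤ.* d , zipWith ℕ._+_ v w) }) Q }) P

_^ₚ_ : ∀ {n} → Poly n → ℕ → Poly n
P ^ₚ zero  = oneₚ
P ^ₚ suc k = P *ₚ (P ^ₚ k)

prodₚ : ∀ {n} {A : Set} → List A → (A → Poly n) → Poly n
prodₚ xs f = foldr (λ a acc → f a *ₚ acc) oneₚ xs

_∣[_]_ : ∀ {n} → Poly n → ℕ → Poly n → Set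
_∣[_]_ {n} H p G = Σ (Poly n) (λ Q → G ≈[ p ] (H *ₚ Q))

-- Polynomials in x over F_p[x_1..x_r] are encoded as Poly (suc r):
-- variable 0 is x, variable (suc l) is x_{l+1}.
xVar : ∀ {r} → Poly (suc r)
xVar = varₚ zero

xsVar : ∀ {r} → Fin r → Poly (suc r)
xsVar l = varₚ (suc l)

fPoly : (r : ℕ) → Poly (suc r)
fPoly r = prodₚ (allFin r) (λ l → xVar -ₚ xsVar l)

ddx : ∀ {r} → Poly (suc r) → Poly (suc r)
ddx = map (λ { (c , (k ∷ v)) → (c ℤ.* (+ k) , (k ∸ 1) ∷ v) })

ddx^ : ∀ {r} → ℕ → Poly (suc r) → Poly (suc r)
ddx^ zero P = P
ddx^ (suc n) P = ddx (ddx^ n P)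

-- F ↦ F[x_i^p, x_j]: writing F = Σ_k c_k x^k, the monomial x^k = (x^p)^{⌊k/p⌋} x^{k mod p}
-- is sent to x_i^{p⌊k/p⌋} x_j^{k mod p}.
bracket : ∀ {r} (p : ℕ) .{{_ : NonZero p}} → Fin r → Fin r → Poly (suc r) → Poly r
bracket p i j = map (λ { (c , (k ∷ v)) →
  (c , updateAt (updateAt v i (λ a → a ℕ.+ p ℕ.* (k / p))) j (λ a → a ℕ.+ k % p)) })

-- Write u = x − x_i, so that x − x_l = (x_i − x_l) + u. With m = 2e − (p − 1) and N = p − e we have
-- m + N = e + 1, so the binomial theorem puts (x − x_l)^e in the ideal ((x_i − x_l)^m, u^N); multiplying
-- over l ≠ i and using the factor u^e of f^e gives f^e ∈ (Δ, u^(e + N)) = (Δ, u^p), where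
-- Δ = ∏_{l ≠ i} (x_i − x_l)^m. By Frobenius u^p = x^p − x_i^p. Like every polynomial free of x, it is a
-- constant for d/dx, so it can be pulled out of any derivative by the Leibniz rule; and the substitution
-- F ↦ F[x_i^p, x_j] sends it to 0 while turning multiplication by a polynomial free of x into
-- multiplication by that polynomial. Hence F[x_i^p, x_j] of every derivative of f^e is a multiple of Δ.
module Submission where

open import Algebra.Bundles using (CommutativeRing)
open import Data.Nat as ℕ using (ℕ; zero; suc; NonZero)
open import Data.Nat.Primality using (Prime)
open import Data.Fin using (Fin)
open import Level using (0ℓ)
open import Relation.Binary.PropositionalEquality as ≡ using (_≡_)

module _ where
  open import Data.Nat
  open import Data.Nat.Properties
  open import Data.Nat.Divisibility
  open import Data.Nat.DivMod using (m/n*n≡m)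
  open import Data.Nat.Primality using (euclidsLemma; ¬prime[1])
  open import Data.Nat.Combinatorics using (_C_; k![n∸k]!∣n!)
  open import Data.Nat.Combinatorics.Specification using (nCk≡n!/k![n-k]!)
  open import Data.Sum using (inj₁; inj₂)
  open import Relation.Nullary using (contradiction)
  open ≡ using (subst; sym; trans; cong)

  prime∤factorial : ∀ {p} → Prime p → ∀ {k} → k < p → p ∤ k !
  prime∤factorial p-prime {zero}  _   p∣1 = ¬prime[1] (subst Prime (∣1⇒≡1 p∣1) p-prime)
  prime∤factorial p-prime {suc k} k<p p∣k! with euclidsLemma (suc k) (k !) p-prime p∣k!
  ... | inj₁ p∣1+k = >⇒∤ k<p p∣1+k
  ... | inj₂ p∣k!  = prime∤factorial p-prime (<-trans (n<1+n k) k<p) p∣k!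

  -- p divides p! = (p C k) · k! · (p ∸ k)!, but neither factorial.
  prime∣binomial : ∀ {p} → Prime p → ∀ {k} → 0 < k → k < p → p ∣ p C k
  prime∣binomial {p@(suc q)} p-prime {k} 0<k k<p
    with euclidsLemma (p C k) (k ! * (p ∸ k) !) p-prime p∣pCk*k!*[p∸k]!
    where
      instance _ = k !* (p ∸ k) !≢0
      p∣pCk*k!*[p∸k]! : p ∣ (p C k) * (k ! * (p ∸ k) !)
      p∣pCk*k!*[p∸k]! = subst (p ∣_)
        (sym (trans (cong (_* (k ! * (p ∸ k) !)) (nCk≡n!/k![n-k]! (<⇒≤ k<p))) (m/n*n≡m (k![n∸k]!∣n! (<⇒≤ k<p)))))
        (m∣m*n (q !))
  ... | inj₁ p∣pCk = p∣pCk
  ... | inj₂ p∣k!*[p∸k]! with euclidsLemma (k !) ((p ∸ k) !) p-prime p∣k!*[p∸k]!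
  ...   | inj₁ p∣k!     = contradiction p∣k! (prime∤factorial p-prime k<p)
  ...   | inj₂ p∣[p∸k]! = contradiction p∣[p∸k]! (prime∤factorial p-prime (∸-monoʳ-< 0<k (<⇒≤ k<p)))

module Frobenius {c ℓ} (R : CommutativeRing c ℓ) where
  open CommutativeRing R hiding (zero)
  open import Data.Nat.Divisibility using (_∣_; divides)
  open import Data.Nat.Combinatorics using (_C_; nCn≡1)
  import Data.Nat.Properties as ℕₚ
  open ℕₚ using (n∸n≡0)
  open import Data.Nat.Primality using (¬prime[0])
  open import Data.Fin using (Fin; zero; suc; inject₁; fromℕ)
  open import Data.Fin.Properties using (toℕ-inject₁; toℕ<n; toℕ-fromℕ)
  open import Data.Empty using (⊥-elim)
  open import Relation.Binary.Reasoning.Setoid setoid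
  open import Algebra.Properties.Semiring.Exp semiring using (_^_; ^-congˡ)
  open import Algebra.Properties.Monoid.Mult +-monoid using (_×_; ×-assocˡ)
  open import Algebra.Properties.Monoid.Sum +-monoid using (sum; sum-init-last; sum-cong-≋; sum-replicate-zero)
  open import Algebra.Properties.CommutativeSemiring.Binomial commutativeSemiring
    using (binomialTerm; theorem)
  open import Algebra.Properties.Group +-group using (inverseʳ-unique)

  private
    p∣n⇒n×≈0 : ∀ {p n} → (∀ x → p × x ≈ 0#) → p ∣ n → ∀ x → n × x ≈ 0#
    p∣n⇒n×≈0 {p} p×≈0 (divides m ≡.refl) x = begin
      (m ℕ.* p) × x   ≡⟨ ≡.cong (_× x) (ℕₚ.*-comm m p) ⟩
      (p ℕ.* m) × x   ≈⟨ ×-assocˡ x p m ⟨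
      p × (m × x)     ≈⟨ p×≈0 (m × x) ⟩
      0#              ∎

  frobenius : ∀ {p} → Prime p → (∀ x → p × x ≈ 0#) → ∀ x y → (x + y) ^ p ≈ x ^ p + y ^ p
  frobenius {zero}    p-prime = ⊥-elim (¬prime[0] p-prime)
  frobenius {p@(suc q)} p-prime p×≈0 x y = begin
    (x + y) ^ p                                                   ≈⟨ theorem p x y ⟩
    term zero + sum (λ k → term (suc k))                          ≈⟨ +-cong refl (sum-init-last {q} (λ k → term (suc k))) ⟩
    term zero + (sum (λ k → term (suc (inject₁ k))) + term (suc (fromℕ q)))
                                                                  ≈⟨ +-cong first (+-cong inner-terms last) ⟩
    y ^ p + (0# + x ^ p)                                          ≈⟨ +-comm _ _ ⟩
    (0# + x ^ p) + y ^ p                                          ≈⟨ +-cong (+-identityˡ _) refl ⟩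
    x ^ p + y ^ p                                                 ∎
    where
      term = binomialTerm x y p

      first : term zero ≈ y ^ p
      first = trans (+-identityʳ _) (*-identityˡ _)

      last : term (suc (fromℕ q)) ≈ x ^ p
      last rewrite toℕ-fromℕ q | nCn≡1 p | n∸n≡0 q = trans (+-identityʳ _) (*-identityʳ _)

      inner-terms : sum (λ k → term (suc (inject₁ k))) ≈ 0#
      inner-terms = trans (sum-cong-≋ inner-term≈0) (sum-replicate-zero q)
        where
          inner-term≈0 : ∀ k → term (suc (inject₁ k)) ≈ 0#
          inner-term≈0 k = p∣n⇒n×≈0 p×≈0
            (prime∣binomial p-prime (ℕ.s≤s ℕ.z≤n) (ℕ.s≤s (≡.subst (ℕ._< q) (≡.sym (toℕ-inject₁ k)) (toℕ<n k))))
            _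

  frobenius-sub : ∀ {p} → Prime p → (∀ x → p × x ≈ 0#) → ∀ x y → (x - y) ^ p ≈ x ^ p - y ^ p
  frobenius-sub {zero}    p-prime = ⊥-elim (¬prime[0] p-prime)
  frobenius-sub {p@(suc q)} p-prime p×≈0 x y =
    trans (frobenius p-prime p×≈0 x (- y)) (+-cong refl (inverseʳ-unique (y ^ p) ((- y) ^ p) y^p-y^p≈0))
    where
      y^p-y^p≈0 : y ^ p + (- y) ^ p ≈ 0#
      y^p-y^p≈0 = begin
        y ^ p + (- y) ^ p   ≈⟨ frobenius p-prime p×≈0 y (- y) ⟨
        (y - y) ^ p         ≈⟨ ^-congˡ p (-‿inverseʳ y) ⟩
        0# * 0# ^ q         ≈⟨ zeroˡ _ ⟩
        0#                  ∎

module ListProduct {c ℓ} (R : CommutativeRing c ℓ) where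
  open CommutativeRing R hiding (zero)
  open import Data.List using (List; []; _∷_; foldr; filter; length)
  open import Data.List.Membership.Propositional using (_∈_)
  open import Data.List.Membership.Propositional.Properties using (∈-filter⁺)
  open import Relation.Binary.Definitions using (DecidableEquality)
  open import Relation.Nullary using (yes; no; ¬?)
  open import Algebra.Properties.Semiring.Exp semiring using (_^_)
  open import Algebra.Properties.CommutativeSemiring.Exp commutativeSemiring using (^-distrib-*)
  open import Algebra.Properties.CommutativeSemigroup *-commutativeSemigroup using (x∙yz≈y∙xz)

  prod : ∀ {a} {A : Set a} → List A → (A → Carrier) → Carrier
  prod xs f = foldr (λ x acc → f x * acc) 1# xs

  prod-^ : ∀ {a} {A : Set a} (xs : List A) (f : A → Carrier) n → prod xs f ^ n ≈ prod xs (λ x → f x ^ n)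
  prod-^ []       f n = 1#^n≈1# n
    where
      1#^n≈1# : ∀ n → 1# ^ n ≈ 1#
      1#^n≈1# ℕ.zero    = refl
      1#^n≈1# (ℕ.suc n) = trans (*-identityˡ _) (1#^n≈1# n)
  prod-^ (x ∷ xs) f n = trans (^-distrib-* (f x) (prod xs f) n) (*-cong refl (prod-^ xs f n))

  module _ {a} {A : Set a} (_≟_ : DecidableEquality A) where

    prod-split : ∀ (f : A → Carrier) y xs →
                 prod xs f ≈ f y ^ length (filter (_≟ y) xs) * prod (filter (λ x → ¬? (x ≟ y)) xs) f
    prod-split f y [] = sym (*-identityˡ 1#)
    prod-split f y (x ∷ xs) with x ≟ y
    ... | yes ≡.refl = trans (*-cong refl (prod-split f y xs)) (sym (*-assoc _ _ _))
    ... | no _       = trans (*-cong refl (prod-split f y xs)) (x∙yz≈y∙xz _ _ _)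

    1≤length-filter-≟ : ∀ {y xs} → y ∈ xs → 1 ℕ.≤ length (filter (_≟ y) xs)
    1≤length-filter-≟ {y} {xs} y∈xs with filter (_≟ y) xs | ∈-filter⁺ (_≟ y) y∈xs ≡.refl
    ... | _ ∷ _ | _ = ℕ.s≤s ℕ.z≤n

module TwoGeneratedIdeal {c ℓ} (R : CommutativeRing c ℓ) where
  open CommutativeRing R hiding (zero)
  open import Level using (_⊔_)
  open import Data.List using ([]; _∷_)
  import Data.Nat.Properties as ℕₚ
  open import Relation.Binary.Reasoning.Setoid setoid
  open ListProduct R using (prod)
  open import Algebra.Properties.Semiring.Exp semiring using (_^_)
  open import Algebra.Solver.Ring.NaturalCoefficients.Default commutativeSemiring
    using (solve; _:=_; _:+_; _:*_)

  infix 4 _∈⟨_,_⟩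
  record _∈⟨_,_⟩ (z a b : Carrier) : Set (c ⊔ ℓ) where
    constructor combination
    field
      s t : Carrier
      z≈as+bt : z ≈ a * s + b * t

  ∈⟨⟩-resp : ∀ {z z′ a a′ b b′} → z ≈ z′ → a ≈ a′ → b ≈ b′ → z ∈⟨ a , b ⟩ → z′ ∈⟨ a′ , b′ ⟩
  ∈⟨⟩-resp z≈z′ a≈a′ b≈b′ (combination s t z≈) =
    combination s t (trans (sym z≈z′) (trans z≈ (+-cong (*-cong a≈a′ refl) (*-cong b≈b′ refl))))

  ∈⟨⟩-+ : ∀ {z w a b} → z ∈⟨ a , b ⟩ → w ∈⟨ a , b ⟩ → z + w ∈⟨ a , b ⟩
  ∈⟨⟩-+ {z} {w} {a} {b} (combination s t z≈) (combination s′ t′ w≈) = combination (s + s′) (t + t′) (begin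
    z + w                                  ≈⟨ +-cong z≈ w≈ ⟩
    (a * s + b * t) + (a * s′ + b * t′)    ≈⟨ solve 6 (λ a b s t s′ t′ →
                                                (a :* s :+ b :* t) :+ (a :* s′ :+ b :* t′)
                                                := a :* (s :+ s′) :+ b :* (t :+ t′)) refl a b s t s′ t′ ⟩
    a * (s + s′) + b * (t + t′)            ∎)

  ∈⟨⟩-*ˡ : ∀ {z a b} x → z ∈⟨ a , b ⟩ → x * z ∈⟨ x * a , b ⟩
  ∈⟨⟩-*ˡ {z} {a} {b} x (combination s t z≈) = combination s (x * t) (begin
    x * z                     ≈⟨ *-cong refl z≈ ⟩
    x * (a * s + b * t)       ≈⟨ solve 5 (λ x a b s t → x :* (a :* s :+ b :* t) := (x :* a) :* s :+ b :* (x :* t))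
                                   refl x a b s t ⟩
    (x * a) * s + b * (x * t) ∎)

  ∈⟨⟩-*ʳ : ∀ {z a b} x → z ∈⟨ a , b ⟩ → x * z ∈⟨ a , x * b ⟩
  ∈⟨⟩-*ʳ {z} {a} {b} x (combination s t z≈) = combination (x * s) t (begin
    x * z                     ≈⟨ *-cong refl z≈ ⟩
    x * (a * s + b * t)       ≈⟨ solve 5 (λ x a b s t → x :* (a :* s :+ b :* t) := a :* (x :* s) :+ (x :* b) :* t)
                                   refl x a b s t ⟩
    a * (x * s) + (x * b) * t ∎)

  ∈⟨⟩-*-absorb : ∀ {z a b} x → z ∈⟨ a , b ⟩ → x * z ∈⟨ a , b ⟩
  ∈⟨⟩-*-absorb {z} {a} {b} x (combination s t z≈) = combination (x * s) (x * t) (begin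
    x * z                       ≈⟨ *-cong refl z≈ ⟩
    x * (a * s + b * t)         ≈⟨ solve 5 (λ x a b s t → x :* (a :* s :+ b :* t) := a :* (x :* s) :+ b :* (x :* t))
                                     refl x a b s t ⟩
    a * (x * s) + b * (x * t)   ∎)

  ∈⟨⟩-* : ∀ {z₁ z₂ a₁ a₂ b} → z₁ ∈⟨ a₁ , b ⟩ → z₂ ∈⟨ a₂ , b ⟩ → z₁ * z₂ ∈⟨ a₁ * a₂ , b ⟩
  ∈⟨⟩-* {z₁} {z₂} {a₁} {a₂} {b} (combination s₁ t₁ z₁≈) (combination s₂ t₂ z₂≈) =
    combination (s₁ * s₂) ((a₁ * s₁) * t₂ + t₁ * z₂) (begin
    z₁ * z₂                                          ≈⟨ *-cong z₁≈ refl ⟩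
    (a₁ * s₁ + b * t₁) * z₂                          ≈⟨ distribʳ z₂ (a₁ * s₁) (b * t₁) ⟩
    (a₁ * s₁) * z₂ + (b * t₁) * z₂                   ≈⟨ +-cong (*-cong refl z₂≈) refl ⟩
    (a₁ * s₁) * (a₂ * s₂ + b * t₂) + (b * t₁) * z₂   ≈⟨ solve 8 (λ a₁ a₂ b s₁ s₂ t₁ t₂ z₂ →
                                                          (a₁ :* s₁) :* (a₂ :* s₂ :+ b :* t₂) :+ (b :* t₁) :* z₂
                                                          := (a₁ :* a₂) :* (s₁ :* s₂) :+ b :* ((a₁ :* s₁) :* t₂ :+ t₁ :* z₂))
                                                          refl a₁ a₂ b s₁ s₂ t₁ t₂ z₂ ⟩
    (a₁ * a₂) * (s₁ * s₂) + b * ((a₁ * s₁) * t₂ + t₁ * z₂) ∎)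

  binomial-∈⟨⟩ : ∀ {k} m n → m ℕ.+ n ≡ suc k → ∀ a b → (a + b) ^ k ∈⟨ a ^ m , b ^ n ⟩
  binomial-∈⟨⟩ {k} zero n _ a b =
    combination ((a + b) ^ k) 0# (sym (trans (+-cong (*-identityˡ _) (zeroʳ _)) (+-identityʳ _)))
  binomial-∈⟨⟩ {k} (suc m) zero _ a b =
    combination 0# ((a + b) ^ k) (sym (trans (+-cong (zeroʳ _) (*-identityˡ _)) (+-identityˡ _)))
  binomial-∈⟨⟩ {zero} (suc m) (suc n) 2+m+n≡1 with ℕₚ.suc-injective (≡.trans (≡.sym (ℕₚ.+-suc (suc m) n)) 2+m+n≡1)
  ... | ()
  binomial-∈⟨⟩ {suc k} (suc m) (suc n) 2+m+n≡2+k a b =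
    ∈⟨⟩-resp (sym (distribʳ _ a b)) refl refl
      (∈⟨⟩-+ (∈⟨⟩-*ˡ a (binomial-∈⟨⟩ m (suc n) (ℕₚ.suc-injective 2+m+n≡2+k) a b))
             (∈⟨⟩-*ʳ b (binomial-∈⟨⟩ (suc m) n
                         (ℕₚ.suc-injective (≡.trans (≡.sym (ℕₚ.+-suc (suc m) n)) 2+m+n≡2+k)) a b)))

  prod-∈⟨⟩ : ∀ {a} {A : Set a} {z g : A → Carrier} {b} xs →
             (∀ x → z x ∈⟨ g x , b ⟩) → prod xs z ∈⟨ prod xs g , b ⟩
  prod-∈⟨⟩ {b = b} []  _  = combination 1# 0# (sym (trans (+-cong (*-identityʳ 1#) (zeroʳ b)) (+-identityʳ 1#)))
  prod-∈⟨⟩ (x ∷ xs) z∈ = ∈⟨⟩-* (z∈ x) (prod-∈⟨⟩ xs z∈)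

module PolynomialsModP (p : ℕ) .{{_ : NonZero p}} where
  open import Defs
  open import Data.Integer using (ℤ; +_; _+_; _*_; -_; _-_)
  import Data.Integer.Properties as ℤₚ
  open import Data.Integer.Divisibility.Signed as ℤ∣ using (_∣_)
  open import Data.Integer.Tactic.RingSolver using (solve-∀)
  open import Data.List using (List; []; _∷_; _++_; map)
  import Data.List.Properties as Listₚ
  open import Data.Product as Prod using (_,_; uncurry)
  open import Relation.Nullary using (yes; no)
  open import Data.Vec using ([]; _∷_; zipWith; replicate; updateAt)
  import Data.Vec.Properties as Vecₚ
  import Data.Nat.Properties as ℕₚ
  open import Data.Nat.DivMod using (_/_; _%_)
  import Data.Nat.DivMod as DivMod
  open import Data.Fin using (zero; suc)
  open import Algebra.Properties.CommutativeSemigroup ℤₚ.*-commutativeSemigroup using (x∙yz≈y∙xz)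
  open ≡ using (refl; cong; cong₂; subst; subst₂)
  open ≡.≡-Reasoning

  private variable
    n m : ℕ
    a b c d : ℤ
    f g : ℤ → Mono n → ℤ
    h h′ : Mono n → ℤ

  infix 4 _≡ₚ_
  record _≡ₚ_ (a b : ℤ) : Set where
    constructor mod-p
    field p∣a-b : + p ∣ a - b
  open _≡ₚ_

  ≡⇒≡ₚ : a ≡ b → a ≡ₚ b
  ≡⇒≡ₚ {a} refl = mod-p (ℤ∣.divides (+ 0) (≡.trans (ℤₚ.+-inverseʳ a) (≡.sym (ℤₚ.*-zeroˡ (+ p)))))

  ≡ₚ-refl : a ≡ₚ a
  ≡ₚ-refl = ≡⇒≡ₚ refl

  ≡ₚ-sym : a ≡ₚ b → b ≡ₚ a
  ≡ₚ-sym {a} {b} (mod-p p∣a-b) = mod-p (subst (+ p ∣_) (-[a-b]≡b-a a b) (ℤ∣.∣m⇒∣-m p∣a-b))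
    where
      -[a-b]≡b-a : ∀ a b → - (a - b) ≡ b - a
      -[a-b]≡b-a = solve-∀

  ≡ₚ-trans : a ≡ₚ b → b ≡ₚ c → a ≡ₚ c
  ≡ₚ-trans {a} {b} {c} (mod-p p∣a-b) (mod-p p∣b-c) =
    mod-p (subst (+ p ∣_) (telescope a b c) (ℤ∣.∣m∣n⇒∣m+n p∣a-b p∣b-c))
    where
      telescope : ∀ a b c → (a - b) + (b - c) ≡ a - c
      telescope = solve-∀

  +-cong-≡ₚ : a ≡ₚ b → c ≡ₚ d → a + c ≡ₚ b + d
  +-cong-≡ₚ {a} {b} {c} {d} (mod-p p∣a-b) (mod-p p∣c-d) =
    mod-p (subst (+ p ∣_) (regroup a b c d) (ℤ∣.∣m∣n⇒∣m+n p∣a-b p∣c-d))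
    where
      regroup : ∀ a b c d → (a - b) + (c - d) ≡ (a + c) - (b + d)
      regroup = solve-∀

  *-congˡ-≡ₚ : ∀ k → a ≡ₚ b → k * a ≡ₚ k * b
  *-congˡ-≡ₚ {a} {b} k (mod-p p∣a-b) = mod-p (subst (+ p ∣_) (distrib k a b) (ℤ∣.∣n⇒∣m*n k p∣a-b))
    where
      distrib : ∀ k a b → k * (a - b) ≡ k * a - k * b
      distrib = solve-∀

  neg-cong-≡ₚ : a ≡ₚ b → - a ≡ₚ - b
  neg-cong-≡ₚ {a} {b} (mod-p p∣a-b) = mod-p (subst (+ p ∣_) (ℤₚ.neg-distrib-+ a (- b)) (ℤ∣.∣m⇒∣-m p∣a-b))

  p*k≡ₚ0 : ∀ k → + p * k ≡ₚ + 0
  p*k≡ₚ0 k = mod-p (ℤ∣.divides k (≡.trans (ℤₚ.+-identityʳ (+ p * k)) (ℤₚ.*-comm (+ p) k)))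

  sumTerms : (ℤ → Mono n → ℤ) → Poly n → ℤ
  sumTerms f []            = + 0
  sumTerms f ((c , v) ∷ P) = f c v + sumTerms f P

  ⟪_∣_⟫ : (Mono n → ℤ) → Poly n → ℤ
  ⟪ h ∣ P ⟫ = sumTerms (λ c v → c * h v) P

  sumTerms-++ : ∀ f (P Q : Poly n) → sumTerms f (P ++ Q) ≡ sumTerms f P + sumTerms f Q
  sumTerms-++ f []            Q = ≡.sym (ℤₚ.+-identityˡ _)
  sumTerms-++ f ((c , v) ∷ P) Q = ≡.trans (cong (λ x → f c v + x) (sumTerms-++ f P Q)) (≡.sym (ℤₚ.+-assoc (f c v) _ _))

  sumTerms-map : ∀ f (t : ℤ Prod.× Mono m → ℤ Prod.× Mono n) (P : Poly m) →
                 sumTerms f (map t P) ≡ sumTerms (λ c v → uncurry f (t (c , v))) P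
  sumTerms-map f t []            = refl
  sumTerms-map f t ((c , v) ∷ P) = cong (λ x → uncurry f (t (c , v)) + x) (sumTerms-map f t P)

  sumTerms-cong : (∀ c v → f c v ≡ g c v) → ∀ (P : Poly n) → sumTerms f P ≡ sumTerms g P
  sumTerms-cong f≗g []            = refl
  sumTerms-cong f≗g ((c , v) ∷ P) = cong₂ _+_ (f≗g c v) (sumTerms-cong f≗g P)

  sumTerms-cong-≡ₚ : (∀ c v → f c v ≡ₚ g c v) → ∀ (P : Poly n) → sumTerms f P ≡ₚ sumTerms g P
  sumTerms-cong-≡ₚ f≡ₚg []            = ≡ₚ-refl
  sumTerms-cong-≡ₚ f≡ₚg ((c , v) ∷ P) = +-cong-≡ₚ (f≡ₚg c v) (sumTerms-cong-≡ₚ f≡ₚg P)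

  sumTerms-+ : ∀ f g (P : Poly n) → sumTerms (λ c v → f c v + g c v) P ≡ sumTerms f P + sumTerms g P
  sumTerms-+ f g []            = refl
  sumTerms-+ f g ((c , v) ∷ P) = ≡.trans (cong (λ x → f c v + g c v + x) (sumTerms-+ f g P))
                                          (interchange (f c v) (g c v) (sumTerms f P) (sumTerms g P))
    where
      interchange : ∀ a b x y → (a + b) + (x + y) ≡ (a + x) + (b + y)
      interchange = solve-∀

  sumTerms-*ˡ : ∀ k f (P : Poly n) → sumTerms (λ c v → k * f c v) P ≡ k * sumTerms f P
  sumTerms-*ˡ k f []            = ≡.sym (ℤₚ.*-zeroʳ k)
  sumTerms-*ˡ k f ((c , v) ∷ P) = ≡.trans (cong (λ x → k * f c v + x) (sumTerms-*ˡ k f P)) (≡.sym (ℤₚ.*-distribˡ-+ k _ _))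

  sumTerms-neg : ∀ f (P : Poly n) → sumTerms (λ c v → - f c v) P ≡ - sumTerms f P
  sumTerms-neg f []            = refl
  sumTerms-neg f ((c , v) ∷ P) = ≡.trans (cong (λ x → - f c v + x) (sumTerms-neg f P)) (≡.sym (ℤₚ.neg-distrib-+ (f c v) _))

  ⟪⟫-cong : (∀ v → h v ≡ h′ v) → ∀ (P : Poly n) → ⟪ h ∣ P ⟫ ≡ ⟪ h′ ∣ P ⟫
  ⟪⟫-cong h≗h′ = sumTerms-cong (λ c v → cong (c *_) (h≗h′ v))

  ⟪⟫-++ : ∀ h (P Q : Poly n) → ⟪ h ∣ P ++ Q ⟫ ≡ ⟪ h ∣ P ⟫ + ⟪ h ∣ Q ⟫
  ⟪⟫-++ h = sumTerms-++ _

  ⟪⟫-neg : ∀ h (P : Poly n) → ⟪ h ∣ negₚ P ⟫ ≡ - ⟪ h ∣ P ⟫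
  ⟪⟫-neg h P = begin
    ⟪ h ∣ negₚ P ⟫                        ≡⟨ sumTerms-map _ _ P ⟩
    sumTerms (λ c v → - c * h v) P        ≡⟨ sumTerms-cong (λ c v → ≡.sym (ℤₚ.neg-distribˡ-* c (h v))) P ⟩
    sumTerms (λ c v → - (c * h v)) P      ≡⟨ sumTerms-neg _ P ⟩
    - ⟪ h ∣ P ⟫                           ∎

  ⟪⟫-+ : ∀ (h h′ : Mono n → ℤ) P → ⟪ (λ v → h v + h′ v) ∣ P ⟫ ≡ ⟪ h ∣ P ⟫ + ⟪ h′ ∣ P ⟫
  ⟪⟫-+ h h′ P = ≡.trans (sumTerms-cong (λ c v → ℤₚ.*-distribˡ-+ c (h v) (h′ v)) P) (sumTerms-+ _ _ P)

  ⟪⟫-*ˡ : ∀ a (h : Mono n → ℤ) P → ⟪ (λ v → a * h v) ∣ P ⟫ ≡ a * ⟪ h ∣ P ⟫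
  ⟪⟫-*ˡ a h P = ≡.trans (sumTerms-cong (λ c v → x∙yz≈y∙xz c a (h v)) P) (sumTerms-*ˡ a _ P)

  ⟪⟫-zero : ∀ (P : Poly n) → ⟪ (λ _ → + 0) ∣ P ⟫ ≡ + 0
  ⟪⟫-zero []            = refl
  ⟪⟫-zero ((c , v) ∷ P) = cong₂ _+_ (ℤₚ.*-zeroʳ c) (⟪⟫-zero P)

  ⟪⟫-swap : ∀ (P : Poly n) (Q : Poly m) (h : Mono n → Mono m → ℤ) →
            ⟪ (λ v → ⟪ h v ∣ Q ⟫) ∣ P ⟫ ≡ ⟪ (λ w → ⟪ (λ v → h v w) ∣ P ⟫) ∣ Q ⟫
  ⟪⟫-swap []            Q h = ≡.sym (⟪⟫-zero Q)
  ⟪⟫-swap ((c , v) ∷ P) Q h = begin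
    c * ⟪ h v ∣ Q ⟫ + ⟪ (λ v → ⟪ h v ∣ Q ⟫) ∣ P ⟫
      ≡⟨ cong₂ _+_ (≡.sym (sumTerms-*ˡ c _ Q)) (⟪⟫-swap P Q h) ⟩
    sumTerms (λ d w → c * (d * h v w)) Q + ⟪ (λ w → ⟪ (λ v → h v w) ∣ P ⟫) ∣ Q ⟫
      ≡⟨ sumTerms-+ _ _ Q ⟨
    sumTerms (λ d w → c * (d * h v w) + d * ⟪ (λ v → h v w) ∣ P ⟫) Q
      ≡⟨ sumTerms-cong (λ d w → factor c d (h v w) _) Q ⟩
    ⟪ (λ w → c * h v w + ⟪ (λ v → h v w) ∣ P ⟫) ∣ Q ⟫ ∎
    where
      factor : ∀ c d x y → c * (d * x) + d * y ≡ d * (c * x + y)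
      factor = solve-∀

  infixl 6 _⊕_
  _⊕_ : Mono n → Mono n → Mono n
  _⊕_ = zipWith ℕ._+_

  0ᵐ : Mono n
  0ᵐ = replicate _ 0

  ⊕-assoc : ∀ (u v w : Mono n) → (u ⊕ v) ⊕ w ≡ u ⊕ (v ⊕ w)
  ⊕-assoc = Vecₚ.zipWith-assoc ℕₚ.+-assoc

  ⊕-comm : ∀ (u v : Mono n) → u ⊕ v ≡ v ⊕ u
  ⊕-comm = Vecₚ.zipWith-comm ℕₚ.+-comm

  ⊕-identityˡ : ∀ (u : Mono n) → 0ᵐ ⊕ u ≡ u
  ⊕-identityˡ = Vecₚ.zipWith-identityˡ ℕₚ.+-identityˡ

  ⊕-leftcomm : ∀ (u v w : Mono n) → u ⊕ (v ⊕ w) ≡ v ⊕ (u ⊕ w)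
  ⊕-leftcomm u v w = begin
    u ⊕ (v ⊕ w)   ≡⟨ ⊕-assoc u v w ⟨
    (u ⊕ v) ⊕ w   ≡⟨ cong (_⊕ w) (⊕-comm u v) ⟩
    (v ⊕ u) ⊕ w   ≡⟨ ⊕-assoc v u w ⟩
    v ⊕ (u ⊕ w)   ∎

  ⟪⟫-* : ∀ h (P Q : Poly n) → ⟪ h ∣ P *ₚ Q ⟫ ≡ ⟪ (λ v → ⟪ (λ w → h (v ⊕ w)) ∣ Q ⟫) ∣ P ⟫
  ⟪⟫-* h []            Q = refl
  ⟪⟫-* h ((c , v) ∷ P) Q = begin
    ⟪ h ∣ map _ Q ++ (P *ₚ Q) ⟫
      ≡⟨ ⟪⟫-++ h (map _ Q) (P *ₚ Q) ⟩
    ⟪ h ∣ map _ Q ⟫ + ⟪ h ∣ P *ₚ Q ⟫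
      ≡⟨ cong₂ _+_ (sumTerms-map _ _ Q) (⟪⟫-* h P Q) ⟩
    sumTerms (λ d w → c * d * h (v ⊕ w)) Q + ⟪ (λ v → ⟪ (λ w → h (v ⊕ w)) ∣ Q ⟫) ∣ P ⟫
      ≡⟨ cong (λ x → x + ⟪ (λ v → ⟪ (λ w → h (v ⊕ w)) ∣ Q ⟫) ∣ P ⟫)
              (≡.trans (sumTerms-cong (λ d w → ℤₚ.*-assoc c d _) Q) (sumTerms-*ˡ c _ Q)) ⟩
    c * ⟪ (λ w → h (v ⊕ w)) ∣ Q ⟫ + ⟪ (λ v → ⟪ (λ w → h (v ⊕ w)) ∣ Q ⟫) ∣ P ⟫ ∎

  -- Two polynomials are identified when every integer-valued weighting of the monomials
  -- sums them to the same residue mod p; the ring laws then become identities between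
  -- integer sums, and weighting by an indicator recovers coefficientwise congruence (≋⇒≈[p]).
  infix 4 _≋_
  record _≋_ (P Q : Poly n) : Set where
    constructor pairings-≡ₚ
    field ⟪_∣⟫-≡ₚ : ∀ h → ⟪ h ∣ P ⟫ ≡ₚ ⟪ h ∣ Q ⟫
  open _≋_

  private variable
    P P′ Q Q′ S : Poly n

  pairings-≡⇒≋ : (∀ h → ⟪ h ∣ P ⟫ ≡ ⟪ h ∣ Q ⟫) → P ≋ Q
  pairings-≡⇒≋ P≡Q = pairings-≡ₚ λ h → ≡⇒≡ₚ (P≡Q h)

  ≋-refl : P ≋ P
  ≋-refl = pairings-≡ₚ λ h → ≡ₚ-refl

  ≋-reflexive : P ≡ Q → P ≋ Q
  ≋-reflexive refl = ≋-refl

  ≋-sym : P ≋ Q → Q ≋ P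
  ≋-sym P≋Q = pairings-≡ₚ λ h → ≡ₚ-sym (⟪ P≋Q ∣⟫-≡ₚ h)

  ≋-trans : P ≋ Q → Q ≋ S → P ≋ S
  ≋-trans P≋Q Q≋S = pairings-≡ₚ λ h → ≡ₚ-trans (⟪ P≋Q ∣⟫-≡ₚ h) (⟪ Q≋S ∣⟫-≡ₚ h)

  +-cong : P ≋ P′ → Q ≋ Q′ → P ++ Q ≋ P′ ++ Q′
  +-cong {P = P} {P′} {Q} {Q′} P≋P′ Q≋Q′ = pairings-≡ₚ λ h →
    subst₂ _≡ₚ_ (≡.sym (⟪⟫-++ h P Q)) (≡.sym (⟪⟫-++ h P′ Q′)) (+-cong-≡ₚ (⟪ P≋P′ ∣⟫-≡ₚ h) (⟪ Q≋Q′ ∣⟫-≡ₚ h))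

  +-assoc : ∀ (P Q S : Poly n) → (P ++ Q) ++ S ≋ P ++ (Q ++ S)
  +-assoc P Q S = pairings-≡⇒≋ λ h → cong ⟪ h ∣_⟫ (Listₚ.++-assoc P Q S)

  +-identityˡ : ∀ (P : Poly n) → [] ++ P ≋ P
  +-identityˡ P = ≋-refl

  +-identityʳ : ∀ (P : Poly n) → P ++ [] ≋ P
  +-identityʳ P = pairings-≡⇒≋ λ h → cong ⟪ h ∣_⟫ (Listₚ.++-identityʳ P)

  +-comm : ∀ (P Q : Poly n) → P ++ Q ≋ Q ++ P
  +-comm P Q = pairings-≡⇒≋ λ h →
    ≡.trans (⟪⟫-++ h P Q) (≡.trans (ℤₚ.+-comm ⟪ h ∣ P ⟫ ⟪ h ∣ Q ⟫) (≡.sym (⟪⟫-++ h Q P)))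

  neg-cong : P ≋ Q → negₚ P ≋ negₚ Q
  neg-cong {P = P} {Q} P≋Q = pairings-≡ₚ λ h →
    subst₂ _≡ₚ_ (≡.sym (⟪⟫-neg h P)) (≡.sym (⟪⟫-neg h Q)) (neg-cong-≡ₚ (⟪ P≋Q ∣⟫-≡ₚ h))

  -‿inverseˡ : ∀ (P : Poly n) → negₚ P ++ P ≋ []
  -‿inverseˡ P = pairings-≡⇒≋ λ h →
    ≡.trans (⟪⟫-++ h (negₚ P) P) (≡.trans (cong (_+ ⟪ h ∣ P ⟫) (⟪⟫-neg h P)) (ℤₚ.+-inverseˡ ⟪ h ∣ P ⟫))

  -‿inverseʳ : ∀ (P : Poly n) → P ++ negₚ P ≋ []
  -‿inverseʳ P = ≋-trans (+-comm P (negₚ P)) (-‿inverseˡ P)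

  *-cong : P ≋ P′ → Q ≋ Q′ → P *ₚ Q ≋ P′ *ₚ Q′
  *-cong {P = P} {P′} {Q} {Q′} P≋P′ Q≋Q′ = pairings-≡ₚ λ h →
    subst₂ _≡ₚ_ (≡.sym (⟪⟫-* h P Q)) (≡.sym (⟪⟫-* h P′ Q′))
      (≡ₚ-trans (sumTerms-cong-≡ₚ (λ c v → *-congˡ-≡ₚ c (⟪ Q≋Q′ ∣⟫-≡ₚ (λ w → h (v ⊕ w)))) P) (⟪ P≋P′ ∣⟫-≡ₚ _))

  *-assoc : ∀ (P Q S : Poly n) → (P *ₚ Q) *ₚ S ≋ P *ₚ (Q *ₚ S)
  *-assoc P Q S = pairings-≡⇒≋ λ h → begin
    ⟪ h ∣ (P *ₚ Q) *ₚ S ⟫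
      ≡⟨ ≡.trans (⟪⟫-* h (P *ₚ Q) S) (⟪⟫-* _ P Q) ⟩
    ⟪ (λ u → ⟪ (λ v → ⟪ (λ w → h ((u ⊕ v) ⊕ w)) ∣ S ⟫) ∣ Q ⟫) ∣ P ⟫
      ≡⟨ ⟪⟫-cong (λ u → ⟪⟫-cong (λ v → ⟪⟫-cong (λ w → cong h (⊕-assoc u v w)) S) Q) P ⟩
    ⟪ (λ u → ⟪ (λ v → ⟪ (λ w → h (u ⊕ (v ⊕ w))) ∣ S ⟫) ∣ Q ⟫) ∣ P ⟫
      ≡⟨ ⟪⟫-cong (λ u → ⟪⟫-* _ Q S) P ⟨
    ⟪ (λ u → ⟪ (λ v → h (u ⊕ v)) ∣ Q *ₚ S ⟫) ∣ P ⟫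
      ≡⟨ ⟪⟫-* h P (Q *ₚ S) ⟨
    ⟪ h ∣ P *ₚ (Q *ₚ S) ⟫ ∎

  *-comm : ∀ (P Q : Poly n) → P *ₚ Q ≋ Q *ₚ P
  *-comm P Q = pairings-≡⇒≋ λ h → begin
    ⟪ h ∣ P *ₚ Q ⟫                                       ≡⟨ ⟪⟫-* h P Q ⟩
    ⟪ (λ v → ⟪ (λ w → h (v ⊕ w)) ∣ Q ⟫) ∣ P ⟫           ≡⟨ ⟪⟫-swap P Q (λ v w → h (v ⊕ w)) ⟩
    ⟪ (λ w → ⟪ (λ v → h (v ⊕ w)) ∣ P ⟫) ∣ Q ⟫           ≡⟨ ⟪⟫-cong (λ w → ⟪⟫-cong (λ v → cong h (⊕-comm v w)) P) Q ⟩
    ⟪ (λ w → ⟪ (λ v → h (w ⊕ v)) ∣ P ⟫) ∣ Q ⟫           ≡⟨ ⟪⟫-* h Q P ⟨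
    ⟪ h ∣ Q *ₚ P ⟫                                       ∎

  *-identityˡ : ∀ (P : Poly n) → oneₚ *ₚ P ≋ P
  *-identityˡ P = pairings-≡⇒≋ λ h → begin
    ⟪ h ∣ oneₚ *ₚ P ⟫                             ≡⟨ ⟪⟫-* h oneₚ P ⟩
    + 1 * ⟪ (λ w → h (0ᵐ ⊕ w)) ∣ P ⟫ + + 0        ≡⟨ ≡.trans (ℤₚ.+-identityʳ _) (ℤₚ.*-identityˡ _) ⟩
    ⟪ (λ w → h (0ᵐ ⊕ w)) ∣ P ⟫                    ≡⟨ ⟪⟫-cong (λ w → cong h (⊕-identityˡ w)) P ⟩
    ⟪ h ∣ P ⟫                                     ∎

  *-identityʳ : ∀ (P : Poly n) → P *ₚ oneₚ ≋ P
  *-identityʳ P = ≋-trans (*-comm P oneₚ) (*-identityˡ P)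

  distribˡ : ∀ (P Q S : Poly n) → P *ₚ (Q ++ S) ≋ P *ₚ Q ++ P *ₚ S
  distribˡ P Q S = pairings-≡⇒≋ λ h → begin
    ⟪ h ∣ P *ₚ (Q ++ S) ⟫
      ≡⟨ ⟪⟫-* h P (Q ++ S) ⟩
    ⟪ (λ v → ⟪ (λ w → h (v ⊕ w)) ∣ Q ++ S ⟫) ∣ P ⟫
      ≡⟨ sumTerms-cong (λ c v → ≡.trans (cong (c *_) (⟪⟫-++ _ Q S)) (ℤₚ.*-distribˡ-+ c _ _)) P ⟩
    sumTerms (λ c v → c * ⟪ (λ w → h (v ⊕ w)) ∣ Q ⟫ + c * ⟪ (λ w → h (v ⊕ w)) ∣ S ⟫) P
      ≡⟨ sumTerms-+ _ _ P ⟩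
    ⟪ (λ v → ⟪ (λ w → h (v ⊕ w)) ∣ Q ⟫) ∣ P ⟫ + ⟪ (λ v → ⟪ (λ w → h (v ⊕ w)) ∣ S ⟫) ∣ P ⟫
      ≡⟨ cong₂ _+_ (⟪⟫-* h P Q) (⟪⟫-* h P S) ⟨
    ⟪ h ∣ P *ₚ Q ⟫ + ⟪ h ∣ P *ₚ S ⟫
      ≡⟨ ⟪⟫-++ h (P *ₚ Q) (P *ₚ S) ⟨
    ⟪ h ∣ P *ₚ Q ++ P *ₚ S ⟫ ∎

  distribʳ : ∀ (P Q S : Poly n) → (Q ++ S) *ₚ P ≋ Q *ₚ P ++ S *ₚ P
  distribʳ P Q S = ≋-trans (*-comm (Q ++ S) P) (≋-trans (distribˡ P Q S) (+-cong (*-comm P Q) (*-comm P S)))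

  polynomialRing : ℕ → CommutativeRing 0ℓ 0ℓ
  polynomialRing n = record
    { Carrier = Poly n
    ; _≈_ = _≋_
    ; _+_ = _++_
    ; _*_ = _*ₚ_
    ; -_ = negₚ
    ; 0# = []
    ; 1# = oneₚ
    ; isCommutativeRing = record
      { isRing = record
        { +-isAbelianGroup = record
          { isGroup = record
            { isMonoid = record
              { isSemigroup = record
                { isMagma = record
                  { isEquivalence = record { refl = ≋-refl ; sym = ≋-sym ; trans = ≋-trans }
                  ; ∙-cong = +-cong }
                ; assoc = +-assoc }
              ; identity = +-identityˡ , +-identityʳ }
            ; inverse = -‿inverseˡ , -‿inverseʳ
            ; ⁻¹-cong = neg-cong }
          ; comm = +-comm }
        ; *-cong = *-cong
        ; *-assoc = *-assoc
        ; *-identity = *-identityˡ , *-identityʳ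
        ; distrib = distribˡ , distribʳ }
      ; *-comm = *-comm }
    }

  module _ {n : ℕ} where
    open import Algebra.Properties.Monoid.Mult (CommutativeRing.+-monoid (polynomialRing n)) using (_×_)
    open import Algebra.Properties.Semiring.Exp (CommutativeRing.semiring (polynomialRing n)) using (_^_)

    p×≋[] : ∀ (P : Poly n) → p × P ≋ []
    p×≋[] P = pairings-≡ₚ λ h → subst₂ _≡ₚ_ (≡.sym (⟪⟫-× h p)) refl (p*k≡ₚ0 ⟪ h ∣ P ⟫)
      where
        ⟪⟫-× : ∀ h k → ⟪ h ∣ k × P ⟫ ≡ + k * ⟪ h ∣ P ⟫
        ⟪⟫-× h zero    = ≡.sym (ℤₚ.*-zeroˡ ⟪ h ∣ P ⟫)
        ⟪⟫-× h (suc k) = begin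
          ⟪ h ∣ P ++ k × P ⟫                  ≡⟨ ⟪⟫-++ h P (k × P) ⟩
          ⟪ h ∣ P ⟫ + ⟪ h ∣ k × P ⟫           ≡⟨ cong (λ x → ⟪ h ∣ P ⟫ + x) (⟪⟫-× h k) ⟩
          ⟪ h ∣ P ⟫ + + k * ⟪ h ∣ P ⟫         ≡⟨ ℤₚ.suc-* (+ k) ⟪ h ∣ P ⟫ ⟨
          + suc k * ⟪ h ∣ P ⟫                 ∎

    ^≡^ₚ : ∀ (P : Poly n) k → P ^ k ≡ P ^ₚ k
    ^≡^ₚ P zero    = refl
    ^≡^ₚ P (suc k) = cong (P *ₚ_) (^≡^ₚ P k)

  ≋⇒≈[p] : ∀ {n} {P Q : Poly n} → P ≋ Q → P ≈[ p ] Q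
  ≋⇒≈[p] {n} {P} {Q} P≋Q m =
    ℤ∣.∣⇒∣ᵤ (subst (+ p ∣_) (cong₂ _-_ (coeff≡⟪⟫ P) (coeff≡⟪⟫ Q)) (p∣a-b (⟪ P≋Q ∣⟫-≡ₚ (indicator m))))
    where
      indicator : ∀ {n} → Mono n → Mono n → ℤ
      indicator m v with Vecₚ.≡-dec ℕ._≟_ v m
      ... | yes _ = + 1
      ... | no _  = + 0

      coeff≡⟪⟫ : ∀ (P : Poly n) → ⟪ indicator m ∣ P ⟫ ≡ coeff P m
      coeff≡⟪⟫ []            = refl
      coeff≡⟪⟫ ((c , v) ∷ P) with Vecₚ.≡-dec ℕ._≟_ v m
      ... | yes _ = cong₂ _+_ (ℤₚ.*-identityʳ c) (coeff≡⟪⟫ P)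
      ... | no _  =
        ≡.trans (cong (_+ ⟪ indicator m ∣ P ⟫) (ℤₚ.*-zeroʳ c)) (≡.trans (ℤₚ.+-identityˡ _) (coeff≡⟪⟫ P))

  module Linear {m n} (F : Poly m → Poly n) (Fᵀ : (Mono n → ℤ) → Mono m → ℤ)
                (⟪⟫-F : ∀ h P → ⟪ h ∣ F P ⟫ ≡ ⟪ Fᵀ h ∣ P ⟫) where

    F-cong : P ≋ Q → F P ≋ F Q
    F-cong {P = P} {Q} P≋Q = pairings-≡ₚ λ h →
      subst₂ _≡ₚ_ (≡.sym (⟪⟫-F h P)) (≡.sym (⟪⟫-F h Q)) (⟪ P≋Q ∣⟫-≡ₚ (Fᵀ h))

    F-++ : ∀ P Q → F (P ++ Q) ≋ F P ++ F Q
    F-++ P Q = pairings-≡⇒≋ λ h → begin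
      ⟪ h ∣ F (P ++ Q) ⟫                  ≡⟨ ≡.trans (⟪⟫-F h (P ++ Q)) (⟪⟫-++ (Fᵀ h) P Q) ⟩
      ⟪ Fᵀ h ∣ P ⟫ + ⟪ Fᵀ h ∣ Q ⟫         ≡⟨ cong₂ _+_ (⟪⟫-F h P) (⟪⟫-F h Q) ⟨
      ⟪ h ∣ F P ⟫ + ⟪ h ∣ F Q ⟫           ≡⟨ ⟪⟫-++ h (F P) (F Q) ⟨
      ⟪ h ∣ F P ++ F Q ⟫                  ∎

    F-neg : ∀ P → F (negₚ P) ≋ negₚ (F P)
    F-neg P = pairings-≡⇒≋ λ h → begin
      ⟪ h ∣ F (negₚ P) ⟫      ≡⟨ ≡.trans (⟪⟫-F h (negₚ P)) (⟪⟫-neg (Fᵀ h) P) ⟩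
      - ⟪ Fᵀ h ∣ P ⟫          ≡⟨ cong -_ (⟪⟫-F h P) ⟨
      - ⟪ h ∣ F P ⟫           ≡⟨ ⟪⟫-neg h (F P) ⟨
      ⟪ h ∣ negₚ (F P) ⟫      ∎

  mono : ℤ → Mono n → Poly n
  mono c v = (c , v) ∷ []

  ⟪⟫-mono* : ∀ h c (v : Mono n) P → ⟪ h ∣ mono c v *ₚ P ⟫ ≡ c * ⟪ (λ w → h (v ⊕ w)) ∣ P ⟫
  ⟪⟫-mono* h c v P = ≡.trans (⟪⟫-* h (mono c v) P) (ℤₚ.+-identityʳ _)

  mono*mono : ∀ a b (v w : Mono n) → mono a v *ₚ mono b w ≋ mono (a * b) (v ⊕ w)
  mono*mono a b v w = +-identityʳ (mono (a * b) (v ⊕ w))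

  unitᵐ : Fin n → ℕ → Mono n
  unitᵐ i k = updateAt 0ᵐ i (ℕ._+ k)

  unitᵐ-+ : ∀ (i : Fin n) a b → unitᵐ i (a ℕ.+ b) ≡ unitᵐ i a ⊕ unitᵐ i b
  unitᵐ-+ {suc n} zero    a b = cong (a ℕ.+ b ∷_) (≡.sym (⊕-identityˡ 0ᵐ))
  unitᵐ-+         (suc i) a b = cong (0 ∷_) (unitᵐ-+ i a b)

  updateAt-+≡unitᵐ⊕ : ∀ (i : Fin n) b (w : Mono n) → updateAt w i (ℕ._+ b) ≡ unitᵐ i b ⊕ w
  updateAt-+≡unitᵐ⊕ zero    b (x ∷ w) = cong₂ _∷_ (ℕₚ.+-comm x b) (≡.sym (⊕-identityˡ w))
  updateAt-+≡unitᵐ⊕ (suc i) b (x ∷ w) = cong (x ∷_) (updateAt-+≡unitᵐ⊕ i b w)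

  var-^ : ∀ (i : Fin n) k → varₚ i ^ₚ k ≋ mono (+ 1) (unitᵐ i k)
  var-^ i zero    = ≋-reflexive (cong (mono (+ 1)) (≡.sym (Vecₚ.updateAt-id-local i 0ᵐ (ℕₚ.+-identityʳ _))))
  var-^ i (suc k) = ≋-trans (*-cong (≋-refl {P = varₚ i}) (var-^ i k)) (≋-trans (mono*mono (+ 1) (+ 1) _ _)
    (≋-reflexive (cong (mono (+ 1)) (≡.trans (cong (_⊕ unitᵐ i k) var≡unitᵐ1) (≡.sym (unitᵐ-+ i 1 k))))))
    where
      var≡unitᵐ1 : updateAt 0ᵐ i (λ _ → 1) ≡ unitᵐ i 1
      var≡unitᵐ1 = Vecₚ.updateAt-cong-local i 0ᵐ (≡.sym (cong (ℕ._+ 1) (Vecₚ.lookup-replicate i 0)))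

  ι : Poly n → Poly (suc n)
  ι = map (Prod.map₂ (0 ∷_))

  ⟪⟫-ι : ∀ h (P : Poly n) → ⟪ h ∣ ι P ⟫ ≡ ⟪ (λ v → h (0 ∷ v)) ∣ P ⟫
  ⟪⟫-ι h P = sumTerms-map _ _ P

  ι-* : ∀ (P Q : Poly n) → ι (P *ₚ Q) ≋ ι P *ₚ ι Q
  ι-* P Q = pairings-≡⇒≋ λ h → begin
    ⟪ h ∣ ι (P *ₚ Q) ⟫                                       ≡⟨ ≡.trans (⟪⟫-ι h (P *ₚ Q)) (⟪⟫-* _ P Q) ⟩
    ⟪ (λ v → ⟪ (λ w → h (0 ∷ v ⊕ w)) ∣ Q ⟫) ∣ P ⟫           ≡⟨ ⟪⟫-cong (λ v → ⟪⟫-ι _ Q) P ⟨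
    ⟪ (λ v → ⟪ (λ w → h ((0 ∷ v) ⊕ w)) ∣ ι Q ⟫) ∣ P ⟫       ≡⟨ ⟪⟫-ι _ P ⟨
    ⟪ (λ v → ⟪ (λ w → h (v ⊕ w)) ∣ ι Q ⟫) ∣ ι P ⟫           ≡⟨ ⟪⟫-* h (ι P) (ι Q) ⟨
    ⟪ h ∣ ι P *ₚ ι Q ⟫                                       ∎

  ι-^ : ∀ (P : Poly n) k → ι (P ^ₚ k) ≋ ι P ^ₚ k
  ι-^ P zero    = ≋-refl
  ι-^ P (suc k) = ≋-trans (ι-* P (P ^ₚ k)) (*-cong (≋-refl {P = ι P}) (ι-^ P k))

  ι-prod : ∀ {A : Set} (xs : List A) (f : A → Poly n) → ι (prodₚ xs f) ≋ prodₚ xs (λ x → ι (f x))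
  ι-prod []       f = ≋-refl
  ι-prod (x ∷ xs) f = ≋-trans (ι-* (f x) (prodₚ xs f)) (*-cong (≋-refl {P = ι (f x)}) (ι-prod xs f))

  ∂ᵀ : (Mono (suc n) → ℤ) → Mono (suc n) → ℤ
  ∂ᵀ h (k ∷ v) = + k * h (k ℕ.∸ 1 ∷ v)

  ⟪⟫-ddx : ∀ h (P : Poly (suc n)) → ⟪ h ∣ ddx P ⟫ ≡ ⟪ ∂ᵀ h ∣ P ⟫
  ⟪⟫-ddx h P = ≡.trans (sumTerms-map _ _ P) (sumTerms-cong (λ { c (k ∷ v) → ℤₚ.*-assoc c (+ k) _ }) P)

  module ddx-linear {n} = Linear (ddx {n}) ∂ᵀ ⟪⟫-ddx

  ∂ᵀ-⊕ : ∀ h (v w : Mono (suc n)) → ∂ᵀ h (v ⊕ w) ≡ ∂ᵀ (λ v′ → h (v′ ⊕ w)) v + ∂ᵀ (λ w′ → h (v ⊕ w′)) w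
  ∂ᵀ-⊕ h (k ∷ v) (l ∷ w) = product-rule k l (λ e → h (e ∷ v ⊕ w))
    where
      product-rule : ∀ k l (g : ℕ → ℤ) →
                     + (k ℕ.+ l) * g (k ℕ.+ l ℕ.∸ 1) ≡ + k * g (k ℕ.∸ 1 ℕ.+ l) + + l * g (k ℕ.+ (l ℕ.∸ 1))
      product-rule zero    l       g = ≡.sym (≡.trans (cong (_+ + l * g (l ℕ.∸ 1)) (ℤₚ.*-zeroˡ (g l))) (ℤₚ.+-identityˡ _))
      product-rule (suc k) zero    g rewrite ℕₚ.+-identityʳ k =
        ≡.sym (≡.trans (cong (λ x → + suc k * g k + x) (ℤₚ.*-zeroˡ (g (suc k)))) (ℤₚ.+-identityʳ _))
      product-rule (suc k) (suc l) g = begin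
        + (suc k ℕ.+ suc l) * g (k ℕ.+ suc l)
          ≡⟨ cong (_* g (k ℕ.+ suc l)) (ℤₚ.pos-+ (suc k) (suc l)) ⟩
        (+ suc k + + suc l) * g (k ℕ.+ suc l)
          ≡⟨ ℤₚ.*-distribʳ-+ (g (k ℕ.+ suc l)) (+ suc k) (+ suc l) ⟩
        + suc k * g (k ℕ.+ suc l) + + suc l * g (k ℕ.+ suc l)
          ≡⟨ cong (λ e → + suc k * g (k ℕ.+ suc l) + + suc l * g e) (ℕₚ.+-suc k l) ⟩
        + suc k * g (k ℕ.+ suc l) + + suc l * g (suc k ℕ.+ l) ∎

  ∂ᵀ-⟪⟫ : ∀ (H : Mono (suc n) → Mono m → ℤ) (Q : Poly m) v →
          ∂ᵀ (λ v′ → ⟪ H v′ ∣ Q ⟫) v ≡ ⟪ (λ w → ∂ᵀ (λ v′ → H v′ w) v) ∣ Q ⟫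
  ∂ᵀ-⟪⟫ H Q (k ∷ v) = ≡.sym (⟪⟫-*ˡ (+ k) _ Q)

  ddx-Leibniz : ∀ (P Q : Poly (suc n)) → ddx (P *ₚ Q) ≋ ddx P *ₚ Q ++ P *ₚ ddx Q
  ddx-Leibniz P Q = pairings-≡⇒≋ λ h → begin
    ⟪ h ∣ ddx (P *ₚ Q) ⟫
      ≡⟨ ≡.trans (⟪⟫-ddx h (P *ₚ Q)) (⟪⟫-* _ P Q) ⟩
    ⟪ (λ v → ⟪ (λ w → ∂ᵀ h (v ⊕ w)) ∣ Q ⟫) ∣ P ⟫
      ≡⟨ ⟪⟫-cong (λ v → ≡.trans (⟪⟫-cong (∂ᵀ-⊕ h v) Q) (⟪⟫-+ _ _ Q)) P ⟩
    ⟪ (λ v → ⟪ (λ w → ∂ᵀ (λ v′ → h (v′ ⊕ w)) v) ∣ Q ⟫ + ⟪ (λ w → ∂ᵀ (λ w′ → h (v ⊕ w′)) w) ∣ Q ⟫) ∣ P ⟫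
      ≡⟨ ⟪⟫-+ _ _ P ⟩
    ⟪ (λ v → ⟪ (λ w → ∂ᵀ (λ v′ → h (v′ ⊕ w)) v) ∣ Q ⟫) ∣ P ⟫ + ⟪ (λ v → ⟪ ∂ᵀ (λ w′ → h (v ⊕ w′)) ∣ Q ⟫) ∣ P ⟫
      ≡⟨ cong₂ _+_ (⟪⟫-cong (∂ᵀ-⟪⟫ (λ v′ w → h (v′ ⊕ w)) Q) P) (⟪⟫-cong (λ v → ⟪⟫-ddx _ Q) P) ⟨
    ⟪ ∂ᵀ (λ v → ⟪ (λ w → h (v ⊕ w)) ∣ Q ⟫) ∣ P ⟫ + ⟪ (λ v → ⟪ (λ w → h (v ⊕ w)) ∣ ddx Q ⟫) ∣ P ⟫
      ≡⟨ cong₂ _+_ (≡.trans (⟪⟫-* h (ddx P) Q) (⟪⟫-ddx _ P)) (⟪⟫-* h P (ddx Q)) ⟨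
    ⟪ h ∣ ddx P *ₚ Q ⟫ + ⟪ h ∣ P *ₚ ddx Q ⟫
      ≡⟨ ⟪⟫-++ h (ddx P *ₚ Q) (P *ₚ ddx Q) ⟨
    ⟪ h ∣ ddx P *ₚ Q ++ P *ₚ ddx Q ⟫ ∎

  ddx-ι : ∀ (P : Poly n) → ddx (ι P) ≋ []
  ddx-ι P = pairings-≡⇒≋ λ h → begin
    ⟪ h ∣ ddx (ι P) ⟫                ≡⟨ ≡.trans (⟪⟫-ddx h (ι P)) (⟪⟫-ι _ P) ⟩
    ⟪ (λ v → + 0 * h (0 ∷ v)) ∣ P ⟫  ≡⟨ ⟪⟫-cong (λ v → ℤₚ.*-zeroˡ (h (0 ∷ v))) P ⟩
    ⟪ (λ _ → + 0) ∣ P ⟫              ≡⟨ ⟪⟫-zero P ⟩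
    + 0                              ∎

  xᵖ : Poly (suc n)
  xᵖ = mono (+ 1) (p ∷ 0ᵐ)

  ddx-xᵖ : ddx (xᵖ {n}) ≋ []
  ddx-xᵖ = pairings-≡ₚ λ h → subst₂ _≡ₚ_
    (≡.sym (≡.trans (ℤₚ.+-identityʳ _) (cong (_* h (p ℕ.∸ 1 ∷ 0ᵐ)) (ℤₚ.*-identityˡ (+ p))))) refl
    (p*k≡ₚ0 (h (p ℕ.∸ 1 ∷ 0ᵐ)))

  module _ (i j : Fin n) where

    shift : ℕ → Mono n
    shift k = unitᵐ j (k % p) ⊕ unitᵐ i (p ℕ.* (k / p))

    shift-p+ : ∀ k → shift (p ℕ.+ k) ≡ unitᵐ i p ⊕ shift k
    shift-p+ k = begin
      unitᵐ j ((p ℕ.+ k) % p) ⊕ unitᵐ i (p ℕ.* ((p ℕ.+ k) / p))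
        ≡⟨ cong₂ (λ a b → unitᵐ j a ⊕ unitᵐ i (p ℕ.* b)) [p+k]%p≡k%p [p+k]/p≡1+k/p ⟩
      unitᵐ j (k % p) ⊕ unitᵐ i (p ℕ.* suc (k / p))
        ≡⟨ cong (λ a → unitᵐ j (k % p) ⊕ a) (≡.trans (cong (unitᵐ i) (ℕₚ.*-suc p (k / p))) (unitᵐ-+ i p _)) ⟩
      unitᵐ j (k % p) ⊕ (unitᵐ i p ⊕ unitᵐ i (p ℕ.* (k / p)))
        ≡⟨ ⊕-leftcomm _ _ _ ⟩
      unitᵐ i p ⊕ shift k ∎
      where
        [p+k]%p≡k%p : (p ℕ.+ k) % p ≡ k % p
        [p+k]%p≡k%p = ≡.trans (cong (_% p) (ℕₚ.+-comm p k)) (DivMod.[m+n]%n≡m%n k p)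
        [p+k]/p≡1+k/p : (p ℕ.+ k) / p ≡ suc (k / p)
        [p+k]/p≡1+k/p = ≡.trans (DivMod.m/n≡1+[m∸n]/n (ℕₚ.m≤m+n p k)) (cong (λ a → suc (a / p)) (ℕₚ.m+n∸m≡n p k))

    bracketᵀ : (Mono n → ℤ) → Mono (suc n) → ℤ
    bracketᵀ h (k ∷ v) = h (shift k ⊕ v)

    ⟪⟫-bracket : ∀ h P → ⟪ h ∣ bracket p i j P ⟫ ≡ ⟪ bracketᵀ h ∣ P ⟫
    ⟪⟫-bracket h P = ≡.trans (sumTerms-map _ _ P) (sumTerms-cong (λ { c (k ∷ v) → cong (λ w → c * h w) (shifted k v) }) P)
      where
        shifted : ∀ k v → updateAt (updateAt v i (ℕ._+ p ℕ.* (k / p))) j (ℕ._+ k % p) ≡ shift k ⊕ v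
        shifted k v = begin
          updateAt (updateAt v i (ℕ._+ p ℕ.* (k / p))) j (ℕ._+ k % p)
            ≡⟨ ≡.trans (updateAt-+≡unitᵐ⊕ j _ _) (cong (unitᵐ j (k % p) ⊕_) (updateAt-+≡unitᵐ⊕ i _ v)) ⟩
          unitᵐ j (k % p) ⊕ (unitᵐ i (p ℕ.* (k / p)) ⊕ v)
            ≡⟨ ⊕-assoc _ _ v ⟨
          shift k ⊕ v ∎

    module bracket-linear = Linear (bracket p i j) bracketᵀ ⟪⟫-bracket

    bracket-ι* : ∀ P Q → bracket p i j (ι P *ₚ Q) ≋ P *ₚ bracket p i j Q
    bracket-ι* P Q = pairings-≡⇒≋ λ h → begin
      ⟪ h ∣ bracket p i j (ι P *ₚ Q) ⟫
        ≡⟨ ≡.trans (⟪⟫-bracket h (ι P *ₚ Q)) (≡.trans (⟪⟫-* _ (ι P) Q) (⟪⟫-ι _ P)) ⟩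
      ⟪ (λ v → ⟪ (λ w → bracketᵀ h ((0 ∷ v) ⊕ w)) ∣ Q ⟫) ∣ P ⟫
        ≡⟨ ⟪⟫-cong (λ v → ⟪⟫-cong (λ { (k ∷ w) → cong h (⊕-leftcomm (shift k) v w) }) Q) P ⟩
      ⟪ (λ v → ⟪ bracketᵀ (λ w → h (v ⊕ w)) ∣ Q ⟫) ∣ P ⟫
        ≡⟨ ≡.trans (⟪⟫-* h P (bracket p i j Q)) (⟪⟫-cong (λ v → ⟪⟫-bracket _ Q) P) ⟨
      ⟪ h ∣ P *ₚ bracket p i j Q ⟫ ∎

    bracket-xᵖ* : ∀ Q → bracket p i j (xᵖ *ₚ Q) ≋ mono (+ 1) (unitᵐ i p) *ₚ bracket p i j Q
    bracket-xᵖ* Q = pairings-≡⇒≋ λ h → begin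
      ⟪ h ∣ bracket p i j (xᵖ *ₚ Q) ⟫
        ≡⟨ ≡.trans (⟪⟫-bracket h (xᵖ *ₚ Q)) (⟪⟫-mono* _ (+ 1) _ Q) ⟩
      + 1 * ⟪ (λ w → bracketᵀ h ((p ∷ 0ᵐ) ⊕ w)) ∣ Q ⟫
        ≡⟨ cong (+ 1 *_) (⟪⟫-cong (λ { (k ∷ w) → cong h (xᵖ-shift k w) }) Q) ⟩
      + 1 * ⟪ bracketᵀ (λ w → h (unitᵐ i p ⊕ w)) ∣ Q ⟫
        ≡⟨ ≡.trans (⟪⟫-mono* h (+ 1) _ (bracket p i j Q)) (cong (+ 1 *_) (⟪⟫-bracket _ Q)) ⟨
      ⟪ h ∣ mono (+ 1) (unitᵐ i p) *ₚ bracket p i j Q ⟫ ∎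
      where
        xᵖ-shift : ∀ k w → shift (p ℕ.+ k) ⊕ (0ᵐ ⊕ w) ≡ unitᵐ i p ⊕ (shift k ⊕ w)
        xᵖ-shift k w = ≡.trans (cong₂ _⊕_ (shift-p+ k) (⊕-identityˡ w)) (⊕-assoc _ _ w)


module BracketOfDerivatives (p : ℕ) .{{_ : NonZero p}} where
  open import Defs
  open PolynomialsModP p
  open import Data.List using ([]; _++_)
  open import Data.Product using (_,_)
  open import Data.Integer using (+_)
  open import Data.Fin using (Fin)
  import Relation.Binary.Reasoning.Setoid as SetoidReasoning

  private
    module ≋-Reasoning {n} = SetoidReasoning (CommutativeRing.setoid (polynomialRing n))
  open ≋-Reasoning

  module _ {n : ℕ} where
    private
      module Rₙ₊₁ = CommutativeRing (polynomialRing (suc n))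
    open import Algebra.Properties.Ring Rₙ₊₁.ring using (-‿distribˡ-*)
    open TwoGeneratedIdeal (polynomialRing (suc n)) using (_∈⟨_,_⟩; combination)

    ddx^-cong : ∀ k {P Q : Poly (suc n)} → P ≋ Q → ddx^ k P ≋ ddx^ k Q
    ddx^-cong zero    P≋Q = P≋Q
    ddx^-cong (suc k) P≋Q = ddx-linear.F-cong (ddx^-cong k P≋Q)

    ddx^-++ : ∀ k (P Q : Poly (suc n)) → ddx^ k (P ++ Q) ≋ ddx^ k P ++ ddx^ k Q
    ddx^-++ zero    P Q = ≋-refl
    ddx^-++ (suc k) P Q = ≋-trans (ddx-linear.F-cong (ddx^-++ k P Q)) (ddx-linear.F-++ (ddx^ k P) (ddx^ k Q))

    ddx^-*-constant : ∀ {C : Poly (suc n)} → ddx C ≋ [] → ∀ k G → ddx^ k (C *ₚ G) ≋ C *ₚ ddx^ k G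
    ddx^-*-constant ddxC≋0 zero    G = ≋-refl
    ddx^-*-constant {C} ddxC≋0 (suc k) G = begin
      ddx (ddx^ k (C *ₚ G))
        ≈⟨ ddx-linear.F-cong (ddx^-*-constant ddxC≋0 k G) ⟩
      ddx (C *ₚ ddx^ k G)
        ≈⟨ ddx-Leibniz C (ddx^ k G) ⟩
      ddx C *ₚ ddx^ k G ++ C *ₚ ddx^ (suc k) G
        ≈⟨ Rₙ₊₁.+-cong (Rₙ₊₁.trans (*-cong ddxC≋0 ≋-refl) (Rₙ₊₁.zeroˡ (ddx^ (suc k) G))) ≋-refl ⟩
      [] ++ C *ₚ ddx^ (suc k) G
        ≈⟨ Rₙ₊₁.+-identityˡ _ ⟩
      C *ₚ ddx^ (suc k) G ∎

    module _ (i : Fin n) where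

      xᵖ-xᵢᵖ : Poly (suc n)
      xᵖ-xᵢᵖ = xᵖ -ₚ ι (varₚ i ^ₚ p)

      ddx-xᵖ-xᵢᵖ : ddx xᵖ-xᵢᵖ ≋ []
      ddx-xᵖ-xᵢᵖ = begin
        ddx xᵖ-xᵢᵖ                                ≈⟨ ddx-linear.F-++ xᵖ _ ⟩
        ddx xᵖ ++ ddx (negₚ (ι (varₚ i ^ₚ p)))    ≈⟨ Rₙ₊₁.+-cong ddx-xᵖ (ddx-linear.F-neg _) ⟩
        [] ++ negₚ (ddx (ι (varₚ i ^ₚ p)))        ≈⟨ neg-cong (ddx-ι _) ⟩
        negₚ []                                   ≈⟨ -‿inverseʳ [] ⟩
        []                                        ∎

      module _ (j : Fin n) where

        bracket-xᵖ-xᵢᵖ* : ∀ G → bracket p i j (xᵖ-xᵢᵖ *ₚ G) ≋ []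
        bracket-xᵖ-xᵢᵖ* G = begin
          bracket p i j (xᵖ-xᵢᵖ *ₚ G)
            ≈⟨ bracket-linear.F-cong i j
                 (≋-trans (distribʳ G xᵖ (negₚ (ι xᵢᵖ))) (+-cong ≋-refl (≋-sym (-‿distribˡ-* (ι xᵢᵖ) G)))) ⟩
          bracket p i j (xᵖ *ₚ G ++ negₚ (ι xᵢᵖ *ₚ G))
            ≈⟨ ≋-trans (bracket-linear.F-++ i j (xᵖ *ₚ G) (negₚ (ι xᵢᵖ *ₚ G)))
                       (+-cong ≋-refl (bracket-linear.F-neg i j (ι xᵢᵖ *ₚ G))) ⟩
          bracket p i j (xᵖ *ₚ G) ++ negₚ (bracket p i j (ι xᵢᵖ *ₚ G))
            ≈⟨ +-cong (bracket-xᵖ* i j G) (neg-cong (bracket-ι* i j xᵢᵖ G)) ⟩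
          mono (+ 1) (unitᵐ i p) *ₚ bracket p i j G ++ negₚ (xᵢᵖ *ₚ bracket p i j G)
            ≈⟨ +-cong ≋-refl (neg-cong (*-cong (var-^ i p) ≋-refl)) ⟩
          mono (+ 1) (unitᵐ i p) *ₚ bracket p i j G ++ negₚ (mono (+ 1) (unitᵐ i p) *ₚ bracket p i j G)
            ≈⟨ -‿inverseʳ (mono (+ 1) (unitᵐ i p) *ₚ bracket p i j G) ⟩
          [] ∎
          where
            xᵢᵖ = varₚ i ^ₚ p

        divides-bracket-ddx^ : ∀ k {F : Poly (suc n)} {D : Poly n} →
                               F ∈⟨ ι D , xᵖ-xᵢᵖ ⟩ → D ∣[ p ] bracket p i j (ddx^ k F)
        divides-bracket-ddx^ k {F} {D} (combination s t F≋) = bracket p i j (ddx^ k s) , ≋⇒≈[p] (begin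
          bracket p i j (ddx^ k F)
            ≈⟨ bracket-linear.F-cong i j (ddx^-cong k F≋) ⟩
          bracket p i j (ddx^ k (ι D *ₚ s ++ xᵖ-xᵢᵖ *ₚ t))
            ≈⟨ bracket-linear.F-cong i j (≋-trans (ddx^-++ k (ι D *ₚ s) (xᵖ-xᵢᵖ *ₚ t))
                 (+-cong (ddx^-*-constant {C = ι D} (ddx-ι D) k s) (ddx^-*-constant {C = xᵖ-xᵢᵖ} ddx-xᵖ-xᵢᵖ k t))) ⟩
          bracket p i j (ι D *ₚ ddx^ k s ++ xᵖ-xᵢᵖ *ₚ ddx^ k t)
            ≈⟨ bracket-linear.F-++ i j (ι D *ₚ ddx^ k s) (xᵖ-xᵢᵖ *ₚ ddx^ k t) ⟩
          bracket p i j (ι D *ₚ ddx^ k s) ++ bracket p i j (xᵖ-xᵢᵖ *ₚ ddx^ k t)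
            ≈⟨ +-cong (bracket-ι* i j D (ddx^ k s)) (bracket-xᵖ-xᵢᵖ* (ddx^ k t)) ⟩
          D *ₚ bracket p i j (ddx^ k s) ++ []
            ≈⟨ +-identityʳ _ ⟩
          D *ₚ bracket p i j (ddx^ k s) ∎)

module Divisibility (p : ℕ) .{{_ : NonZero p}} (p-prime : Prime p) {r : ℕ} (i : Fin r) where
  open import Defs
  open PolynomialsModP p using (polynomialRing; _≋_; ≋-reflexive; ≋-sym; neg-cong; ^≡^ₚ; var-^; ι; ι-^; ι-prod; p×≋[])
  open BracketOfDerivatives p using (xᵖ-xᵢᵖ)
  open import Data.List using (List; []; filter; allFin; length)
  open import Data.List.Membership.Propositional.Properties using (∈-allFin)
  open import Data.Product using (∃; _,_)
  open import Relation.Nullary using (¬?)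
  open import Data.Fin as Fin using (_≟_)

  R : CommutativeRing 0ℓ 0ℓ
  R = polynomialRing (suc r)

  open CommutativeRing R
    using (_+_; _*_; _-_; setoid; refl; sym; trans; +-cong; *-cong; *-assoc; +-comm; +-assoc; -‿inverseˡ; +-identityˡ)
  open import Relation.Binary.Reasoning.Setoid setoid
  open import Algebra.Properties.Semiring.Exp (CommutativeRing.semiring R) using (_^_; ^-congˡ; ^-homo-*)
  open import Algebra.Properties.CommutativeSemiring.Exp (CommutativeRing.commutativeSemiring R) using (^-distrib-*)
  open Frobenius R using (frobenius-sub)
  open ListProduct R using (prod-^; prod-split; 1≤length-filter-≟)
  open TwoGeneratedIdeal R

  u : Poly (suc r)
  u = xVar - xsVar i

  g : Fin r → Poly (suc r)
  g l = xVar - xsVar l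

  others : List (Fin r)
  others = filter (λ l → ¬? (l ≟ i)) (allFin r)

  Δ : ℕ → Poly r
  Δ m = prodₚ others (λ l → (varₚ i -ₚ varₚ l) ^ₚ m)

  W : Poly (suc r)
  W = prodₚ others g

  ^≈^ₚ : ∀ (P : Poly (suc r)) k → P ^ k ≋ P ^ₚ k
  ^≈^ₚ P k = ≋-reflexive (^≡^ₚ P k)

  u^p≈xᵖ-xᵢᵖ : u ^ p ≋ xᵖ-xᵢᵖ i
  u^p≈xᵖ-xᵢᵖ = begin
    u ^ p                       ≈⟨ frobenius-sub p-prime p×≋[] xVar (xsVar i) ⟩
    xVar ^ p - xsVar i ^ p      ≈⟨ +-cong (^≈^ₚ xVar p) (neg-cong (^≈^ₚ (xsVar i) p)) ⟩
    xVar ^ₚ p - xsVar i ^ₚ p    ≈⟨ +-cong (var-^ Fin.zero p) (neg-cong (≋-sym (ι-^ (varₚ i) p))) ⟩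
    xᵖ-xᵢᵖ i                    ∎

  x-xₗ≈[xᵢ-xₗ]+[x-xᵢ] : ∀ l → g l ≋ (xsVar i - xsVar l) + u
  x-xₗ≈[xᵢ-xₗ]+[x-xᵢ] l = sym (begin
    (xᵢ - xₗ) + (xVar - xᵢ)          ≈⟨ +-comm (xᵢ - xₗ) u ⟩
    (xVar - xᵢ) + (xᵢ - xₗ)          ≈⟨ +-assoc xVar (negₚ xᵢ) (xᵢ - xₗ) ⟩
    xVar + (negₚ xᵢ + (xᵢ - xₗ))     ≈⟨ +-cong (refl {x = xVar}) (sym (+-assoc (negₚ xᵢ) xᵢ (negₚ xₗ))) ⟩
    xVar + ((negₚ xᵢ + xᵢ) - xₗ)     ≈⟨ +-cong (refl {x = xVar}) (+-cong (-‿inverseˡ xᵢ) refl) ⟩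
    xVar + ([] - xₗ)                 ≈⟨ +-cong (refl {x = xVar}) (+-identityˡ (negₚ xₗ)) ⟩
    g l                              ∎)
    where
      xᵢ = xsVar i
      xₗ = xsVar l

  f≈u*[u^c*W] : ∃ λ c → fPoly r ≋ u * (u ^ c * W)
  f≈u*[u^c*W] with length (filter (_≟ i) (allFin r)) | prod-split _≟_ g i (allFin r) | 1≤length-filter-≟ _≟_ (∈-allFin i)
  ... | zero  | _            | ()
  ... | suc c | f≈u^[1+c]*W | _ = c , trans f≈u^[1+c]*W (*-assoc u (u ^ c) W)

  module _ {e m N : ℕ} (m+N≡1+e : m ℕ.+ N ≡ suc e) (e+N≡p : e ℕ.+ N ≡ p) where

    g^e∈ : ∀ l → g l ^ e ∈⟨ ι ((varₚ i -ₚ varₚ l) ^ₚ m) , u ^ N ⟩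
    g^e∈ l = ∈⟨⟩-resp (^-congˡ e (sym (x-xₗ≈[xᵢ-xₗ]+[x-xᵢ] l)))
                      (trans (^≈^ₚ _ m) (≋-sym (ι-^ (varₚ i -ₚ varₚ l) m))) refl
                      (binomial-∈⟨⟩ m N m+N≡1+e (xsVar i - xsVar l) u)

    W^e∈ : W ^ e ∈⟨ ι (Δ m) , u ^ N ⟩
    W^e∈ = ∈⟨⟩-resp (sym (prod-^ others g e)) (≋-sym (ι-prod others (λ l → (varₚ i -ₚ varₚ l) ^ₚ m))) refl
                    (prod-∈⟨⟩ others g^e∈)

    f^e∈ : fPoly r ^ₚ e ∈⟨ ι (Δ m) , xᵖ-xᵢᵖ i ⟩
    f^e∈ with f≈u*[u^c*W]
    ... | c , f≈u*[u^c*W] =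
      ∈⟨⟩-resp f^e≈ refl u^e*u^N≈xᵖ-xᵢᵖ (∈⟨⟩-*ʳ (u ^ e) (∈⟨⟩-*-absorb ((u ^ c) ^ e) W^e∈))
      where
        f^e≈ : u ^ e * ((u ^ c) ^ e * W ^ e) ≋ fPoly r ^ₚ e
        f^e≈ = begin
          u ^ e * ((u ^ c) ^ e * W ^ e)   ≈⟨ *-cong (refl {x = u ^ e}) (^-distrib-* (u ^ c) W e) ⟨
          u ^ e * (u ^ c * W) ^ e         ≈⟨ ^-distrib-* u (u ^ c * W) e ⟨
          (u * (u ^ c * W)) ^ e           ≈⟨ ^-congˡ e f≈u*[u^c*W] ⟨
          fPoly r ^ e                     ≈⟨ ^≈^ₚ (fPoly r) e ⟩
          fPoly r ^ₚ e                    ∎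
        u^e*u^N≈xᵖ-xᵢᵖ : u ^ e * u ^ N ≋ xᵖ-xᵢᵖ i
        u^e*u^N≈xᵖ-xᵢᵖ = trans (sym (^-homo-* u e N)) (trans (≋-reflexive (≡.cong (u ^_) e+N≡p)) u^p≈xᵖ-xᵢᵖ)

  divisibility : ∀ (j : Fin r) {e m N} k → m ℕ.+ N ≡ suc e → e ℕ.+ N ≡ p →
                 Δ m ∣[ p ] bracket p i j (ddx^ k (fPoly r ^ₚ e))
  divisibility j k m+N≡1+e e+N≡p = BracketOfDerivatives.divides-bracket-ddx^ p i j k (f^e∈ m+N≡1+e e+N≡p)

module _ where
  open import Data.Nat
  open import Data.Nat.Properties
  open ≡.≡-Reasoning

  exponents-sum : ∀ {q e} → q < 2 * e → e ≤ q → (2 * e ∸ q) + (suc q ∸ e) ≡ suc e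
  exponents-sum {q} {e} q<2e e≤q = begin
    (2 * e ∸ q) + (suc q ∸ e)       ≡⟨ ≡.cong ((2 * e ∸ q) +_) (+-∸-assoc 1 e≤q) ⟩
    (2 * e ∸ q) + suc (q ∸ e)       ≡⟨ +-suc (2 * e ∸ q) (q ∸ e) ⟩
    suc ((2 * e ∸ q) + (q ∸ e))     ≡⟨ ≡.cong suc (+-∸-assoc (2 * e ∸ q) e≤q) ⟨
    suc ((2 * e ∸ q) + q ∸ e)       ≡⟨ ≡.cong (λ x → suc (x ∸ e)) (m∸n+n≡m (<⇒≤ q<2e)) ⟩
    suc (2 * e ∸ e)                 ≡⟨ ≡.cong suc (≡.trans (m+n∸m≡n e (e + 0)) (+-identityʳ e)) ⟩
    suc e                           ∎

open import Defs
open import Data.Nat using (_≤_; _<_; _∸_; _*_)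
open import Data.Nat.Properties using (m+[n∸m]≡n; m≤n⇒m≤1+n)
open import Data.List using (allFin; filter)
open import Relation.Nullary using (¬?)
open import Data.Fin using (_≟_)

lemma1 : (p : ℕ) .{{_ : NonZero p}} → Prime p → (r e d : ℕ) → 2 ≤ r →
         p ∸ 1 < 2 * e → e ≤ p ∸ 1 → 1 ≤ d → d ≤ p →
         (i j : Fin r) →
         (prodₚ (filter (λ l → ¬? (l ≟ i)) (allFin r)) (λ l → (varₚ i -ₚ varₚ l) ^ₚ (2 * e ∸ (p ∸ 1))))
           ∣[ p ] bracket p i j (ddx^ (p ∸ d) (fPoly r ^ₚ e))
lemma1 p@(suc q) p-prime r e d _ q<2e e≤q _ _ i j =
  Divisibility.divisibility p p-prime i j (p ∸ d) (exponents-sum q<2e e≤q) (m+[n∸m]≡n (m≤n⇒m≤1+n e≤q))
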